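{- Let $k$ be a field, $e, h \geq 1$ integers, and $M$ a finite-dimensional $k$-vector space with a $k[T]/T^e$-module structure, generated by at most $h$ elements as a $k[T]/T^e$-module. For $1 \leq i \leq e$ put $\delta_i := \dim_k M[T^i]/M[T^{i-1}]$ (so $\delta_1 \geq \dots \geq \delta_e$). Then $\mathrm{Hdg}(M) = P(\delta_1, \dots, \delta_e)$.
   Context: $M[T^i]$ denotes the kernel of multiplication by $T^i$ on $M$. Writing $M \simeq \bigoplus_{i=1}^h k[T]/T^{a_i}$ with $0 \leq a_i \leq e$, the Hodge polygon $\mathrm{Hdg}(M)$ is the convex polygon on $[0,h]$, starting at $0$ at $x=0$, with slopes $a_1/e, \dots, a_h/e$ (each with multiplicity one, arranged in increasing order). For integers $d_1,\dots,d_N \in[0,h]$, $P(d_1, \dots, d_N)(x) = \frac{1}{N}\sum_{i=1}^N \max(0, x + d_i - h)$ for $x \in [0,h]$.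
   Formalization: The identity $\mathrm{Hdg}(M) = P(\delta_1, \dots, \delta_e)$ is asserted only at rational x in [0,h] rather than at all real x, with both polygons taken as functions on the rationals. -}

module Defs where

open import Level using (Level; _⊔_) renaming (suc to lsuc)
open import Algebra.Bundles using (CommutativeRing)
open import Relation.Nullary using (¬_)
open import Data.Product using (Σ; ∃; _×_)
open import Data.Nat as ℕ using (ℕ; zero; suc; NonZero)
open import Data.Fin using (Fin; toℕ)
import Data.Fin as Fin
open import Data.Integer using (+_)
open import Data.Rational as ℚ using (ℚ; 0ℚ; 1ℚ)
open import Data.List using (List; []; _∷_; tabulate)
import Data.Nat.Properties as ℕP
open import Data.List.Sort.InsertionSort ℕP.≤-decTotalOrder using (sort)

record Field (c ℓ : Level) : Set (lsuc (c ⊔ ℓ)) where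
  field
    commutativeRing : CommutativeRing c ℓ
  open CommutativeRing commutativeRing public
  field
    0≉1     : ¬ (0# ≈ 1#)
    inverse : ∀ x → ¬ (x ≈ 0#) → ∃ λ y → (x * y) ≈ 1#

-- Linear algebra over a field k, with M = k^n (vectors Fin n → k) and the
-- action of T given by an n×n matrix.

module LinAlg {c ℓ : Level} (F : Field c ℓ) where
  open Field F renaming (Carrier to K)

  ∑ : {m : ℕ} → (Fin m → K) → K
  ∑ {zero}  f = 0#
  ∑ {suc m} f = f Fin.zero + ∑ (λ j → f (Fin.suc j))

  Vect : ℕ → Set c
  Vect n = Fin n → K

  _≋_ : {n : ℕ} → Vect n → Vect n → Set ℓ
  u ≋ v = ∀ r → u r ≈ v r

  𝟎 : {n : ℕ} → Vect n
  𝟎 _ = 0#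

  _⊖_ : {n : ℕ} → Vect n → Vect n → Vect n
  (u ⊖ v) r = u r - v r

  _·_ : {n : ℕ} → K → Vect n → Vect n
  (a · v) r = a * v r

  ∑v : {n m : ℕ} → (Fin m → Vect n) → Vect n
  ∑v f r = ∑ (λ j → f j r)

  lincomb : {n d : ℕ} → (Fin d → K) → (Fin d → Vect n) → Vect n
  lincomb cs b = ∑v (λ j → cs j · b j)

  Mat : ℕ → Set c
  Mat n = Fin n → Fin n → K

  apply : {n : ℕ} → Mat n → Vect n → Vect n
  apply A v r = ∑ (λ s → A r s * v s)

  pow : {n : ℕ} → Mat n → ℕ → Vect n → Vect n
  pow A zero    v = v
  pow A (suc m) v = apply A (pow A m v)

  Ker : {n : ℕ} → Mat n → ℕ → Vect n → Set ℓ
  Ker A i v = pow A i v ≋ 𝟎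

  -- T^e = 0, i.e. the action of T makes M a k[T]/T^e-module
  KillsTe : {n : ℕ} → Mat n → ℕ → Set (c ⊔ ℓ)
  KillsTe A e = ∀ v → pow A e v ≋ 𝟎

  -- M is generated by (at most) h elements as a k[T]/T^e-module:
  -- every v equals Σ_i p_i(T) g_i with p_i polynomials of degree < e.
  GeneratedBy : {n : ℕ} → Mat n → (e h : ℕ) → Set (c ⊔ ℓ)
  GeneratedBy {n} A e h =
    Σ (Fin h → Vect n) λ g →
      ∀ v → Σ (Fin h → Fin e → K) λ cs →
        v ≋ ∑v (λ i → ∑v (λ j → cs i j · pow A (toℕ j) (g i)))

  -- dim_k (W / W') = d  (W' ⊆ W subspaces, given as predicates):
  -- there are d vectors of W forming a basis of W modulo W'.
  QuotDim : {n : ℕ} → (W W' : Vect n → Set ℓ) → ℕ → Set (c ⊔ ℓ)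
  QuotDim {n} W W' d =
    Σ (Fin d → Vect n) λ b →
      (∀ j → W (b j)) ×
      (∀ (cs : Fin d → K) → W' (lincomb cs b) → ∀ j → cs j ≈ 0#) ×
      (∀ w → W w → Σ (Fin d → K) λ cs → W' (w ⊖ lincomb cs b))

  -- M ≃ ⊕_{i=1}^h k[T]/T^{a_i} as k[T]-modules, written out: there are
  -- g_1..g_h with T^{a_i} g_i = 0 such that the vectors T^j g_i
  -- (1 ≤ i ≤ h, 0 ≤ j < a_i) form a k-basis of M (they are the images of
  -- the standard k-basis T^j of the summands).
  Decomposition : {n : ℕ} → Mat n → (h : ℕ) → (Fin h → ℕ) → Set (c ⊔ ℓ)
  Decomposition {n} A h a =
    Σ (Fin h → Vect n) λ g →
      (∀ i → pow A (a i) (g i) ≋ 𝟎) ×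
      (∀ (cs : (i : Fin h) → Fin (a i) → K) →
         ∑v (λ i → ∑v (λ j → cs i j · pow A (toℕ j) (g i))) ≋ 𝟎 →
         ∀ i j → cs i j ≈ 0#) ×
      (∀ v → Σ ((i : Fin h) → Fin (a i) → K) λ cs →
         v ≋ ∑v (λ i → ∑v (λ j → cs i j · pow A (toℕ j) (g i))))

-- Polygons (as functions ℚ → ℚ, meant on [0,h]).

ℕ→ℚ : ℕ → ℚ
ℕ→ℚ n = (+ n) ℚ./ 1

clamp : ℚ → ℚ
clamp t = 1ℚ ℚ.⊓ (0ℚ ℚ.⊔ t)

-- convex polygon from 0 whose j-th segment (on [j, j+1]) has slope s_j/e,
-- for a list s = s_0, s_1, ... (the list is read as increasing slopes)
polyFrom : (e : ℕ) → .{{_ : NonZero e}} → List ℕ → ℕ → ℚ → ℚ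
polyFrom e []       j x = 0ℚ
polyFrom e (s ∷ ss) j x =
  ((+ s) ℚ./ e) ℚ.* clamp (x ℚ.- ℕ→ℚ j) ℚ.+ polyFrom e ss (suc j) x

-- Hdg(M) for M ≃ ⊕_{i=1}^h k[T]/T^{a_i}: slopes a_1/e, ..., a_h/e
-- arranged in increasing order.
Hdg : (e : ℕ) → .{{_ : NonZero e}} → {h : ℕ} → (Fin h → ℕ) → ℚ → ℚ
Hdg e a x = polyFrom e (sort (tabulate a)) 0 x

∑ℚ : {N : ℕ} → (Fin N → ℚ) → ℚ
∑ℚ {zero}  f = 0ℚ
∑ℚ {suc N} f = f Fin.zero ℚ.+ ∑ℚ (λ j → f (Fin.suc j))

P : (N : ℕ) → .{{_ : NonZero N}} → (h : ℕ) → (Fin N → ℕ) → ℚ → ℚ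
P N h d x = ((+ 1) ℚ./ N) ℚ.* ∑ℚ (λ i → 0ℚ ℚ.⊔ (x ℚ.+ ℕ→ℚ (d i) ℚ.- ℕ→ℚ h))

-- Write M ≃ ⊕ k[T]/T^(a_j) with generators g_j. For each i the vectors T^(a_j − 1 − i) g_j
-- with i < a_j lie in M[T^(i+1)] and form a basis of it modulo M[T^i]; since the dimension
-- of such a quotient is well defined (a homogeneous linear system with more unknowns than
-- equations has a nonzero solution), δ_(i+1) = #{j | i < a_j}.
-- On the other side, a sorted slope list a_(1) ≤ … ≤ a_(h) contributes on [j, j+1] the
-- segment (a/e)·clamp(x − j), and clamp(x − j) appears in exactly the a summands of
-- P with i < a: peeling off max(0, t) = clamp t + max(0, t − 1) one segment at a time turns
-- Hdg into (1/e) Σ_i max(0, x + #{j | i < a_j} − h).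
module Submission where

open import Defs
open import Level using (Level)
open import Data.Nat as ℕ using (ℕ; zero; suc; NonZero; _≤_; _<_; _<?_; _<ᵇ_; _∸_; s≤s; z≤n)
import Data.Nat.Properties as ℕ
open import Data.Fin as Fin using (Fin; toℕ; punchIn)
open import Data.Fin.Properties using (toℕ-fromℕ<)
open import Data.Bool using (true; false; if_then_else_)
open import Data.List using (List; []; _∷_; length; filter; tabulate)
open import Data.List.Properties using (filter-all; filter-accept; filter-reject)
open import Data.List.Relation.Unary.Linked using ([-]; _∷_)
open import Data.List.Relation.Unary.Linked.Properties using (Linked⇒All)
open import Data.List.Relation.Binary.Permutation.Propositional using (_↭_)
open import Data.List.Relation.Binary.Permutation.Propositional.Properties using (↭-length; filter-↭)
open import Data.List.Relation.Unary.Sorted.TotalOrder ℕ.≤-totalOrder using (Sorted)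
open import Data.Product using (∃; _×_; _,_; proj₁; proj₂)
open import Data.Rational using (ℚ; 0ℚ) renaming (_≤_ to _≤ℚ_)
open import Data.Sum using (_⊎_; inj₁; inj₂)
open import Data.Empty using (⊥-elim)
open import Data.Vec.Functional using (insertAt)
open import Data.Vec.Functional.Properties using (insertAt-lookup; insertAt-punchIn)
open import Function using (_∘_)
open import Relation.Nullary using (¬_; yes; no; does; ofʸ; ofⁿ)
open import Relation.Nullary.Decidable using (dec-true; dec-false; ¬¬-excluded-middle)
open import Relation.Nullary.Negation using (contradiction; negated-stable; ¬¬-map)
open import Relation.Binary.PropositionalEquality as ≡ using (_≡_; _≢_)

countAbove : ℕ → List ℕ → ℕ
countAbove i = length ∘ filter (i <?_)

countAbove-↭ : ∀ i {xs ys} → xs ↭ ys → countAbove i xs ≡ countAbove i ys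
countAbove-↭ i = ↭-length ∘ filter-↭ (i <?_)

countAbove-accept : ∀ {i s} ss → i < s → countAbove i (s ∷ ss) ≡ suc (countAbove i ss)
countAbove-accept {i} _ i<s = ≡.cong length (filter-accept (i <?_) i<s)

countAbove-reject : ∀ {i s} ss → ¬ i < s → countAbove i (s ∷ ss) ≡ countAbove i ss
countAbove-reject {i} _ i≮s = ≡.cong length (filter-reject (i <?_) i≮s)

countAbove-sorted : ∀ {i s ss} → Sorted (s ∷ ss) → i < s → countAbove i ss ≡ length ss
countAbove-sorted [-]        i<s = ≡.refl
countAbove-sorted (s≤t ∷ st) i<s =
  ≡.cong length (filter-all (_ <?_) (Linked⇒All ℕ.≤-trans (ℕ.≤-trans i<s s≤t) st))

-- Case splits are on the Boolean i <ᵇ a j, since that is what filter (i <?_) reduces to.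
select : ∀ {h} (a : Fin h → ℕ) i → Fin (countAbove i (tabulate a)) → Fin h
select {suc h} a i t with i <ᵇ a Fin.zero
select {suc h} a i Fin.zero    | true  = Fin.zero
select {suc h} a i (Fin.suc t) | true  = Fin.suc (select (a ∘ Fin.suc) i t)
select {suc h} a i t           | false = Fin.suc (select (a ∘ Fin.suc) i t)

select-above : ∀ {h} (a : Fin h → ℕ) i t → i < a (select a i t)
select-above {suc h} a i t with i <ᵇ a Fin.zero | ℕ.<ᵇ-reflects-< i (a Fin.zero)
select-above {suc h} a i Fin.zero    | true  | ofʸ i<a₀ = i<a₀
select-above {suc h} a i (Fin.suc t) | true  | _        = select-above (a ∘ Fin.suc) i t
select-above {suc h} a i t           | false | _        = select-above (a ∘ Fin.suc) i t

module Polygon where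

  open import Data.Integer as ℤ using (+_)
  import Data.Integer.Properties as ℤ
  open import Data.Integer.Solver using () renaming (module +-*-Solver to ℤ-Solver)
  open import Data.List.Properties using (length-tabulate)
  open import Data.List.Relation.Unary.All using (All; []; _∷_)
  open import Data.List.Relation.Unary.All.Properties using (tabulate⁺)
  open import Data.List.Relation.Unary.Linked using ([])
  open import Data.List.Relation.Binary.Permutation.Propositional using (↭-sym)
  open import Data.List.Relation.Binary.Permutation.Propositional.Properties using (All-resp-↭)
  open import Data.List.Sort.InsertionSort ℕ.≤-decTotalOrder using (sort)
  open import Data.List.Sort.InsertionSort.Properties ℕ.≤-decTotalOrder using (sort-↭; sort-↗)
  open import Data.Rational as ℚ using (1ℚ; _+_; _-_; _*_; _⊔_; toℚᵘ; fromℚᵘ)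
  import Data.Rational.Properties as ℚ
  import Data.Rational.Unnormalised as ℚᵘ
  import Data.Rational.Unnormalised.Properties as ℚᵘ
  import Data.Rational.Solver as ℚ-Solver
  open ≡ using (refl; sym; trans; cong; cong₂; subst; module ≡-Reasoning)

  -- ℕ→ℚ n and + s / suc d are by definition fromℚᵘ (mkℚᵘ (+ n) 0) and fromℚᵘ (mkℚᵘ (+ s) d),
  -- so identities between them can be checked in ℚᵘ.
  fromℚᵘ-homo-+ : ∀ p q → fromℚᵘ (p ℚᵘ.+ q) ≡ fromℚᵘ p + fromℚᵘ q
  fromℚᵘ-homo-+ p q = ℚ.toℚᵘ-injective (begin
    toℚᵘ (fromℚᵘ (p ℚᵘ.+ q))                ≈⟨ ℚ.toℚᵘ-fromℚᵘ _ ⟩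
    p ℚᵘ.+ q                                ≈⟨ ℚᵘ.+-cong (ℚ.toℚᵘ-fromℚᵘ p) (ℚ.toℚᵘ-fromℚᵘ q) ⟨
    toℚᵘ (fromℚᵘ p) ℚᵘ.+ toℚᵘ (fromℚᵘ q)   ≈⟨ ℚ.toℚᵘ-homo-+ (fromℚᵘ p) (fromℚᵘ q) ⟨
    toℚᵘ (fromℚᵘ p + fromℚᵘ q)              ∎)
    where open ℚᵘ.≃-Reasoning

  fromℚᵘ-homo-* : ∀ p q → fromℚᵘ (p ℚᵘ.* q) ≡ fromℚᵘ p * fromℚᵘ q
  fromℚᵘ-homo-* p q = ℚ.toℚᵘ-injective (begin
    toℚᵘ (fromℚᵘ (p ℚᵘ.* q))                ≈⟨ ℚ.toℚᵘ-fromℚᵘ _ ⟩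
    p ℚᵘ.* q                                ≈⟨ ℚᵘ.*-cong (ℚ.toℚᵘ-fromℚᵘ p) (ℚ.toℚᵘ-fromℚᵘ q) ⟨
    toℚᵘ (fromℚᵘ p) ℚᵘ.* toℚᵘ (fromℚᵘ q)   ≈⟨ ℚ.toℚᵘ-homo-* (fromℚᵘ p) (fromℚᵘ q) ⟨
    toℚᵘ (fromℚᵘ p * fromℚᵘ q)              ∎)
    where open ℚᵘ.≃-Reasoning

  ℕ→ℚ-homo-+ : ∀ m n → ℕ→ℚ (m ℕ.+ n) ≡ ℕ→ℚ m + ℕ→ℚ n
  ℕ→ℚ-homo-+ m n = trans (ℚ.fromℚᵘ-cong {ℚᵘ.mkℚᵘ (+ (m ℕ.+ n)) 0} {ℚᵘ.mkℚᵘ (+ m) 0 ℚᵘ.+ ℚᵘ.mkℚᵘ (+ n) 0} (ℚᵘ.*≡* eq))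
                         (fromℚᵘ-homo-+ (ℚᵘ.mkℚᵘ (+ m) 0) (ℚᵘ.mkℚᵘ (+ n) 0))
    where
    open ℤ-Solver
    eq : + (m ℕ.+ n) ℤ.* (+ 1 ℤ.* + 1) ≡ (+ m ℤ.* + 1 ℤ.+ + n ℤ.* + 1) ℤ.* + 1
    eq = trans (cong (λ k → k ℤ.* (+ 1 ℤ.* + 1)) (ℤ.pos-+ m n))
               (solve 2 (λ a b → (a :+ b) :* (con (+ 1) :* con (+ 1)) := (a :* con (+ 1) :+ b :* con (+ 1)) :* con (+ 1)) refl (+ m) (+ n))

  /-≡*-ℕ→ℚ : ∀ s d → (+ s) ℚ./ suc d ≡ ((+ 1) ℚ./ suc d) * ℕ→ℚ s
  /-≡*-ℕ→ℚ s d = trans (ℚ.fromℚᵘ-cong {ℚᵘ.mkℚᵘ (+ s) d} {ℚᵘ.mkℚᵘ (+ 1) d ℚᵘ.* ℚᵘ.mkℚᵘ (+ s) 0} (ℚᵘ.*≡* eq))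
                         (fromℚᵘ-homo-* (ℚᵘ.mkℚᵘ (+ 1) d) (ℚᵘ.mkℚᵘ (+ s) 0))
    where
    open ℤ-Solver
    eq : + s ℤ.* (+ suc d ℤ.* + 1) ≡ (+ 1 ℤ.* + s) ℤ.* + suc d
    eq = solve 2 (λ a b → a :* (b :* con (+ 1)) := (con (+ 1) :* a) :* b) refl (+ s) (+ suc d)

  open ℚ-Solver.+-*-Solver using (_:+_; _:-_; _:*_; _:=_; con) renaming (solve to ℚsolve)

  0≤1 : 0ℚ ≤ℚ 1ℚ
  0≤1 = ℚ.nonNegative⁻¹ 1ℚ

  t≤1⇒t-1≤0 : ∀ {t} → t ≤ℚ 1ℚ → t - 1ℚ ≤ℚ 0ℚ
  t≤1⇒t-1≤0 t≤1 = ℚ.≤-trans (ℚ.+-monoˡ-≤ (ℚ.- 1ℚ) t≤1) (ℚ.≤-reflexive (ℚ.+-inverseʳ 1ℚ))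

  1≤t⇒0≤t-1 : ∀ {t} → 1ℚ ≤ℚ t → 0ℚ ≤ℚ t - 1ℚ
  1≤t⇒0≤t-1 1≤t = ℚ.≤-trans (ℚ.≤-reflexive (sym (ℚ.+-inverseʳ 1ℚ))) (ℚ.+-monoˡ-≤ (ℚ.- 1ℚ) 1≤t)

  clamp-≤0 : ∀ t → t ≤ℚ 0ℚ → clamp t ≡ 0ℚ
  clamp-≤0 t t≤0 = trans (cong (1ℚ ℚ.⊓_) (ℚ.p≥q⇒p⊔q≡p t≤0)) (ℚ.p≥q⇒p⊓q≡q 0≤1)

  clamp-[0,1] : ∀ t → 0ℚ ≤ℚ t → t ≤ℚ 1ℚ → clamp t ≡ t
  clamp-[0,1] t 0≤t t≤1 = trans (cong (1ℚ ℚ.⊓_) (ℚ.p≤q⇒p⊔q≡q 0≤t)) (ℚ.p≥q⇒p⊓q≡q t≤1)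

  clamp-≥1 : ∀ t → 1ℚ ≤ℚ t → clamp t ≡ 1ℚ
  clamp-≥1 t 1≤t = trans (cong (1ℚ ℚ.⊓_) (ℚ.p≤q⇒p⊔q≡q (ℚ.≤-trans 0≤1 1≤t))) (ℚ.p≤q⇒p⊓q≡p 1≤t)

  0⊔-clamp-split : ∀ t → 0ℚ ⊔ t ≡ clamp t + (0ℚ ⊔ (t - 1ℚ))
  0⊔-clamp-split t with ℚ.≤-total t 0ℚ
  ... | inj₁ t≤0 = begin
    0ℚ ⊔ t                   ≡⟨ ℚ.p≥q⇒p⊔q≡p t≤0 ⟩
    0ℚ                       ≡⟨ ℚ.+-identityʳ 0ℚ ⟨
    0ℚ + 0ℚ                  ≡⟨ cong₂ _+_ (sym (clamp-≤0 t t≤0)) (sym (ℚ.p≥q⇒p⊔q≡p (t≤1⇒t-1≤0 (ℚ.≤-trans t≤0 0≤1)))) ⟩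
    clamp t + (0ℚ ⊔ (t - 1ℚ))  ∎
    where open ≡-Reasoning
  ... | inj₂ 0≤t with ℚ.≤-total t 1ℚ
  ...   | inj₁ t≤1 = begin
    0ℚ ⊔ t                   ≡⟨ ℚ.p≤q⇒p⊔q≡q 0≤t ⟩
    t                        ≡⟨ ℚ.+-identityʳ t ⟨
    t + 0ℚ                   ≡⟨ cong₂ _+_ (sym (clamp-[0,1] t 0≤t t≤1)) (sym (ℚ.p≥q⇒p⊔q≡p (t≤1⇒t-1≤0 t≤1))) ⟩
    clamp t + (0ℚ ⊔ (t - 1ℚ))  ∎
    where open ≡-Reasoning
  ...   | inj₂ 1≤t = begin
    0ℚ ⊔ t                   ≡⟨ ℚ.p≤q⇒p⊔q≡q 0≤t ⟩
    t                        ≡⟨ ℚsolve 1 (λ u → u := con 1ℚ :+ (u :- con 1ℚ)) refl t ⟩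
    1ℚ + (t - 1ℚ)            ≡⟨ cong₂ _+_ (sym (clamp-≥1 t 1≤t)) (sym (ℚ.p≤q⇒p⊔q≡q (1≤t⇒0≤t-1 1≤t))) ⟩
    clamp t + (0ℚ ⊔ (t - 1ℚ))  ∎
    where open ≡-Reasoning

  ∑ℚ-cong : ∀ {N} {f g : Fin N → ℚ} → (∀ i → f i ≡ g i) → ∑ℚ f ≡ ∑ℚ g
  ∑ℚ-cong {zero}  f≗g = refl
  ∑ℚ-cong {suc N} f≗g = cong₂ _+_ (f≗g Fin.zero) (∑ℚ-cong (f≗g ∘ Fin.suc))

  ∑ℚ-0 : ∀ N → ∑ℚ {N} (λ _ → 0ℚ) ≡ 0ℚ
  ∑ℚ-0 zero    = refl
  ∑ℚ-0 (suc N) = trans (ℚ.+-identityˡ _) (∑ℚ-0 N)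

  ∑ℚ-distrib-+ : ∀ {N} (f g : Fin N → ℚ) → ∑ℚ (λ i → f i + g i) ≡ ∑ℚ f + ∑ℚ g
  ∑ℚ-distrib-+ {zero}  f g = refl
  ∑ℚ-distrib-+ {suc N} f g = begin
    f₀ + g₀ + ∑ℚ (λ i → f (Fin.suc i) + g (Fin.suc i)) ≡⟨ cong (λ u → f₀ + g₀ + u) (∑ℚ-distrib-+ (f ∘ Fin.suc) (g ∘ Fin.suc)) ⟩
    f₀ + g₀ + (∑f + ∑g)                                ≡⟨ ℚsolve 4 (λ a b c d → a :+ b :+ (c :+ d) := a :+ c :+ (b :+ d)) refl f₀ g₀ ∑f ∑g ⟩
    f₀ + ∑f + (g₀ + ∑g)                                ∎
    where
    open ≡-Reasoning
    f₀ = f Fin.zero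
    g₀ = g Fin.zero
    ∑f = ∑ℚ (f ∘ Fin.suc)
    ∑g = ∑ℚ (g ∘ Fin.suc)

  indicator : ℕ → ℕ → ℚ → ℚ
  indicator i s c = if does (i <? s) then c else 0ℚ

  indicator-< : ∀ {i s} c → i < s → indicator i s c ≡ c
  indicator-< {i} {s} c i<s rewrite dec-true (i <? s) i<s = refl

  indicator-≮ : ∀ {i s} c → ¬ i < s → indicator i s c ≡ 0ℚ
  indicator-≮ {i} {s} c i≮s rewrite dec-false (i <? s) i≮s = refl

  ∑ℚ-indicator : ∀ {N} s c → s ℕ.≤ N → ∑ℚ {N} (λ i → indicator (toℕ i) s c) ≡ ℕ→ℚ s * c
  ∑ℚ-indicator {N}     zero    c _         = trans (∑ℚ-0 N) (sym (ℚ.*-zeroˡ c))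
  ∑ℚ-indicator {suc N} (suc s) c (s≤s s≤N) = begin
    c + ∑ℚ {N} (λ i → indicator (toℕ i) s c) ≡⟨ cong (λ u → c + u) (∑ℚ-indicator s c s≤N) ⟩
    c + ℕ→ℚ s * c                           ≡⟨ ℚsolve 2 (λ a b → a :+ b :* a := (con 1ℚ :+ b) :* a) refl c (ℕ→ℚ s) ⟩
    (1ℚ + ℕ→ℚ s) * c                        ≡⟨ cong (_* c) (ℕ→ℚ-homo-+ 1 s) ⟨
    ℕ→ℚ (suc s) * c                         ∎
    where open ≡-Reasoning

  excess : ℚ → ℕ → ℕ → ℚ
  excess x h d = 0ℚ ⊔ (x + ℕ→ℚ d - ℕ→ℚ h)

  P-cong : ∀ N .{{_ : NonZero N}} h {d d′ : Fin N → ℕ} → (∀ i → d i ≡ d′ i) → ∀ x → P N h d x ≡ P N h d′ x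
  P-cong N h d≗d′ x = cong ((+ 1 ℚ./ N) *_) (∑ℚ-cong (λ i → cong (excess x h) (d≗d′ i)))

  x+k-[j+k]≡x-j : ∀ x j k → x + ℕ→ℚ k - ℕ→ℚ (j ℕ.+ k) ≡ x - ℕ→ℚ j
  x+k-[j+k]≡x-j x j k = begin
    x + ℕ→ℚ k - ℕ→ℚ (j ℕ.+ k)      ≡⟨ cong (λ u → x + ℕ→ℚ k - u) (ℕ→ℚ-homo-+ j k) ⟩
    x + ℕ→ℚ k - (ℕ→ℚ j + ℕ→ℚ k)    ≡⟨ ℚsolve 3 (λ a b c → a :+ c :- (b :+ c) := a :- b) refl x (ℕ→ℚ j) (ℕ→ℚ k) ⟩
    x - ℕ→ℚ j                      ∎
    where open ≡-Reasoning

  excess-sorted-cons : ∀ x j i {s ss} → Sorted (s ∷ ss) →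
    excess x (j ℕ.+ suc (length ss)) (countAbove i (s ∷ ss))
      ≡ indicator i s (clamp (x - ℕ→ℚ j)) + excess x (suc j ℕ.+ length ss) (countAbove i ss)
  excess-sorted-cons x j i {s} {ss} sorted with i <? s
  ... | yes i<s = begin
    excess x (j ℕ.+ suc L) (countAbove i (s ∷ ss))             ≡⟨ cong (excess x (j ℕ.+ suc L)) (countAbove-accept ss i<s) ⟩
    0ℚ ⊔ (x + ℕ→ℚ (suc (countAbove i ss)) - ℕ→ℚ (j ℕ.+ suc L)) ≡⟨ cong (λ k → 0ℚ ⊔ (x + ℕ→ℚ (suc k) - ℕ→ℚ (j ℕ.+ suc L))) all-above ⟩
    0ℚ ⊔ (x + ℕ→ℚ (suc L) - ℕ→ℚ (j ℕ.+ suc L))                ≡⟨ cong (0ℚ ⊔_) (x+k-[j+k]≡x-j x j (suc L)) ⟩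
    0ℚ ⊔ (x - ℕ→ℚ j)                                          ≡⟨ 0⊔-clamp-split (x - ℕ→ℚ j) ⟩
    c + (0ℚ ⊔ (x - ℕ→ℚ j - 1ℚ))                               ≡⟨ cong (λ u → c + (0ℚ ⊔ u)) x-j-1 ⟨
    c + excess x (suc j ℕ.+ L) L                              ≡⟨ cong₂ (λ u k → u + excess x (suc j ℕ.+ L) k) (indicator-< c i<s) all-above ⟨
    indicator i s c + excess x (suc j ℕ.+ L) (countAbove i ss) ∎
    where
    open ≡-Reasoning
    L = length ss
    c = clamp (x - ℕ→ℚ j)
    all-above = countAbove-sorted sorted i<s
    x-j-1 : x + ℕ→ℚ L - ℕ→ℚ (suc j ℕ.+ L) ≡ x - ℕ→ℚ j - 1ℚ
    x-j-1 = begin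
      x + ℕ→ℚ L - ℕ→ℚ (suc j ℕ.+ L) ≡⟨ x+k-[j+k]≡x-j x (suc j) L ⟩
      x - ℕ→ℚ (1 ℕ.+ j)            ≡⟨ cong (x -_) (ℕ→ℚ-homo-+ 1 j) ⟩
      x - (1ℚ + ℕ→ℚ j)             ≡⟨ ℚsolve 2 (λ a b → a :- (con 1ℚ :+ b) := a :- b :- con 1ℚ) refl x (ℕ→ℚ j) ⟩
      x - ℕ→ℚ j - 1ℚ               ∎
  ... | no i≮s = begin
    excess x (j ℕ.+ suc L) (countAbove i (s ∷ ss))             ≡⟨ cong (excess x (j ℕ.+ suc L)) (countAbove-reject ss i≮s) ⟩
    excess x (j ℕ.+ suc L) (countAbove i ss)                   ≡⟨ cong (λ h → excess x h (countAbove i ss)) (ℕ.+-suc j L) ⟩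
    excess x (suc j ℕ.+ L) (countAbove i ss)                   ≡⟨ ℚ.+-identityˡ _ ⟨
    0ℚ + excess x (suc j ℕ.+ L) (countAbove i ss)              ≡⟨ cong (_+ excess x (suc j ℕ.+ L) (countAbove i ss)) (indicator-≮ c i≮s) ⟨
    indicator i s c + excess x (suc j ℕ.+ L) (countAbove i ss) ∎
    where
    open ≡-Reasoning
    L = length ss
    c = clamp (x - ℕ→ℚ j)

  excess-0 : ∀ x h → x ≤ℚ ℕ→ℚ h → excess x h 0 ≡ 0ℚ
  excess-0 x h x≤h = ℚ.p≥q⇒p⊔q≡p (begin
    x + 0ℚ - ℕ→ℚ h       ≡⟨ cong (_- ℕ→ℚ h) (ℚ.+-identityʳ x) ⟩
    x - ℕ→ℚ h            ≤⟨ ℚ.+-monoˡ-≤ (ℚ.- ℕ→ℚ h) x≤h ⟩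
    ℕ→ℚ h - ℕ→ℚ h        ≡⟨ ℚ.+-inverseʳ (ℕ→ℚ h) ⟩
    0ℚ                   ∎)
    where open ℚ.≤-Reasoning

  polyFrom≡P : ∀ e s j x → Sorted s → All (ℕ._≤ suc e) s → x ≤ℚ ℕ→ℚ (j ℕ.+ length s) →
    polyFrom (suc e) s j x ≡ P (suc e) (j ℕ.+ length s) (λ i → countAbove (toℕ i) s) x
  polyFrom≡P e [] j x _ _ x≤j = sym (begin
    1/e * ∑ℚ {suc e} (λ _ → excess x (j ℕ.+ 0) 0) ≡⟨ cong (1/e *_) (∑ℚ-cong {suc e} (λ _ → excess-0 x (j ℕ.+ 0) x≤j)) ⟩
    1/e * ∑ℚ {suc e} (λ _ → 0ℚ)                   ≡⟨ cong (1/e *_) (∑ℚ-0 (suc e)) ⟩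
    1/e * 0ℚ                                      ≡⟨ ℚ.*-zeroʳ 1/e ⟩
    0ℚ                                            ∎)
    where
    open ≡-Reasoning
    1/e = + 1 ℚ./ suc e
  polyFrom≡P e (s ∷ ss) j x sorted (s≤e ∷ ss≤e) x≤h = begin
    (+ s ℚ./ suc e) * c + polyFrom (suc e) ss (suc j) x
      ≡⟨ cong₂ (λ u v → u * c + v) (/-≡*-ℕ→ℚ s e) (polyFrom≡P e ss (suc j) x (tail sorted) ss≤e x≤h′) ⟩
    1/e * ℕ→ℚ s * c + 1/e * ∑ℚ rest
      ≡⟨ ℚsolve 4 (λ a b u v → a :* b :* u :+ a :* v := a :* (b :* u :+ v)) refl 1/e (ℕ→ℚ s) c (∑ℚ rest) ⟩
    1/e * (ℕ→ℚ s * c + ∑ℚ rest)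
      ≡⟨ cong (λ u → 1/e * (u + ∑ℚ rest)) (∑ℚ-indicator s c s≤e) ⟨
    1/e * (∑ℚ first + ∑ℚ rest)
      ≡⟨ cong (1/e *_) (∑ℚ-distrib-+ first rest) ⟨
    1/e * ∑ℚ (λ i → first i + rest i)
      ≡⟨ cong (1/e *_) (∑ℚ-cong {suc e} (λ i → excess-sorted-cons x j (toℕ i) sorted)) ⟨
    1/e * ∑ℚ {suc e} (λ i → excess x (j ℕ.+ suc (length ss)) (countAbove (toℕ i) (s ∷ ss)))
      ≡⟨⟩
    P (suc e) (j ℕ.+ length (s ∷ ss)) (λ i → countAbove (toℕ i) (s ∷ ss)) x
      ∎
    where
    open ≡-Reasoning
    1/e = + 1 ℚ./ suc e
    c = clamp (x - ℕ→ℚ j)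
    first rest : Fin (suc e) → ℚ
    first i = indicator (toℕ i) s c
    rest i = excess x (suc j ℕ.+ length ss) (countAbove (toℕ i) ss)
    tail : ∀ {t ts} → Sorted (t ∷ ts) → Sorted ts
    tail [-]       = []
    tail (_ ∷ st) = st
    x≤h′ : x ≤ℚ ℕ→ℚ (suc j ℕ.+ length ss)
    x≤h′ = subst (λ k → x ≤ℚ ℕ→ℚ k) (ℕ.+-suc j (length ss)) x≤h

  Hdg≡P-countAbove : ∀ e h (a : Fin h → ℕ) → (∀ j → a j ℕ.≤ suc e) → ∀ x → x ≤ℚ ℕ→ℚ h →
    Hdg (suc e) a x ≡ P (suc e) h (λ i → countAbove (toℕ i) (tabulate a)) x
  Hdg≡P-countAbove e h a a≤e x x≤h = begin
    polyFrom (suc e) sorted 0 x                                   ≡⟨ polyFrom≡P e sorted 0 x (sort-↗ (tabulate a)) sorted≤e (subst (λ k → x ≤ℚ ℕ→ℚ k) (sym length≡h) x≤h) ⟩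
    P (suc e) (length sorted) (λ i → countAbove (toℕ i) sorted) x ≡⟨ cong (λ k → P (suc e) k (λ i → countAbove (toℕ i) sorted) x) length≡h ⟩
    P (suc e) h (λ i → countAbove (toℕ i) sorted) x               ≡⟨ P-cong (suc e) h (λ i → countAbove-↭ (toℕ i) (sort-↭ (tabulate a))) x ⟩
    P (suc e) h (λ i → countAbove (toℕ i) (tabulate a)) x         ∎
    where
    open ≡-Reasoning
    sorted = sort (tabulate a)
    length≡h : length sorted ≡ h
    length≡h = trans (↭-length (sort-↭ (tabulate a))) (length-tabulate a)
    sorted≤e : All (ℕ._≤ suc e) sorted
    sorted≤e = All-resp-↭ (↭-sym (sort-↭ (tabulate a))) (tabulate⁺ a≤e)

n∸1<n : ∀ {m n} → m < n → n ∸ 1 < n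
n∸1<n {n = suc n} _ = ℕ.n<1+n n

n∸[1+m]<n : ∀ {m n} → m < n → n ∸ suc m < n
n∸[1+m]<n {m} {suc n} _ = s≤s (ℕ.m∸n≤m n m)

-- With n = a_j: T^m moves every coefficient index k except the top one and the
-- ones above it to a_j or beyond, where T^k g_j vanishes.
n≤m+k : ∀ m n k → ¬ suc m ℕ.+ k < n → k ≢ n ∸ suc m → n ℕ.≤ m ℕ.+ k
n≤m+k m n k ≮ k≢ = ℕ.≤-pred (ℕ.≤∧≢⇒< (ℕ.≮⇒≥ ≮) λ n≡ → k≢ (≡.trans (≡.sym (ℕ.m+n∸m≡n (suc m) k)) (≡.cong (_∸ suc m) (≡.sym n≡))))

module Linear {c ℓ : Level} (F : Field c ℓ) where

  open import Level using (_⊔_)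
  open Field F renaming (Carrier to K)
  open LinAlg F
  open import Algebra.Properties.Ring ring using (x∙y⁻¹≈ε⇒x≈y; x[y-z]≈xy-xz; -‿+-comm; -0#≈0#; -‿distribˡ-*)
  open import Algebra.Properties.CommutativeSemigroup +-commutativeSemigroup using (interchange; x∙yz≈y∙xz)
  open import Relation.Binary.Reasoning.Setoid setoid

  ∑-cong : ∀ {m} {f g : Fin m → K} → (∀ j → f j ≈ g j) → ∑ f ≈ ∑ g
  ∑-cong {zero}  f≈g = refl
  ∑-cong {suc m} f≈g = +-cong (f≈g Fin.zero) (∑-cong (f≈g ∘ Fin.suc))

  ∑-zero : ∀ {m} {f : Fin m → K} → (∀ j → f j ≈ 0#) → ∑ f ≈ 0#
  ∑-zero {zero}  f≈0 = refl
  ∑-zero {suc m} f≈0 = trans (+-cong (f≈0 Fin.zero) (∑-zero (f≈0 ∘ Fin.suc))) (+-identityˡ 0#)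

  ∑-distrib-+ : ∀ {m} (f g : Fin m → K) → ∑ (λ j → f j + g j) ≈ ∑ f + ∑ g
  ∑-distrib-+ {zero}  f g = sym (+-identityˡ 0#)
  ∑-distrib-+ {suc m} f g = trans (+-congˡ (∑-distrib-+ (f ∘ Fin.suc) (g ∘ Fin.suc)))
                                  (interchange (f Fin.zero) (g Fin.zero) _ _)

  -‿distrib-∑ : ∀ {m} (f : Fin m → K) → - ∑ f ≈ ∑ (λ j → - f j)
  -‿distrib-∑ {zero}  f = -0#≈0#
  -‿distrib-∑ {suc m} f = trans (sym (-‿+-comm _ _)) (+-congˡ (-‿distrib-∑ (f ∘ Fin.suc)))

  ∑-distrib-- : ∀ {m} (f g : Fin m → K) → ∑ (λ j → f j - g j) ≈ ∑ f - ∑ g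
  ∑-distrib-- f g = trans (∑-distrib-+ f (λ j → - g j)) (+-congˡ (sym (-‿distrib-∑ g)))

  *-distribˡ-∑ : ∀ {m} a (f : Fin m → K) → a * ∑ f ≈ ∑ (λ j → a * f j)
  *-distribˡ-∑ {zero}  a f = zeroʳ a
  *-distribˡ-∑ {suc m} a f = trans (distribˡ a _ _) (+-congˡ (*-distribˡ-∑ a (f ∘ Fin.suc)))

  *-distribʳ-∑ : ∀ {m} a (f : Fin m → K) → ∑ f * a ≈ ∑ (λ j → f j * a)
  *-distribʳ-∑ {zero}  a f = zeroˡ a
  *-distribʳ-∑ {suc m} a f = trans (distribʳ a _ _) (+-congˡ (*-distribʳ-∑ a (f ∘ Fin.suc)))

  ∑-comm : ∀ {m k} (f : Fin m → Fin k → K) → ∑ (λ j → ∑ (f j)) ≈ ∑ (λ l → ∑ (λ j → f j l))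
  ∑-comm {zero} {k} f = sym (∑-zero {k} (λ _ → refl))
  ∑-comm {suc m} f = begin
    ∑ (f Fin.zero) + ∑ (λ j → ∑ (f (Fin.suc j)))         ≈⟨ +-congˡ (∑-comm (f ∘ Fin.suc)) ⟩
    ∑ (f Fin.zero) + ∑ (λ l → ∑ (λ j → f (Fin.suc j) l)) ≈⟨ ∑-distrib-+ (f Fin.zero) _ ⟨
    ∑ (λ l → f Fin.zero l + ∑ (λ j → f (Fin.suc j) l))   ∎

  ∑-punchIn : ∀ {m} (p : Fin (suc m)) (f : Fin (suc m) → K) → ∑ f ≈ f p + ∑ (f ∘ punchIn p)
  ∑-punchIn Fin.zero f = refl
  ∑-punchIn {suc m} (Fin.suc p) f = trans (+-congˡ (∑-punchIn p (f ∘ Fin.suc))) (x∙yz≈y∙xz _ _ _)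

  -- Bind of the double-negation monad, for do-notation; unlike ¬¬-Monad it may change universe level.
  infixl 1 _>>=_
  _>>=_ : ∀ {a b} {A : Set a} {B : Set b} → ¬ ¬ A → (A → ¬ ¬ B) → ¬ ¬ B
  m >>= f = negated-stable (¬¬-map f m)

  return : ∀ {a} {A : Set a} → A → ¬ ¬ A
  return = contradiction

  Solves : ∀ {d m} → (Fin d → Fin m → K) → (Fin d → K) → Set ℓ
  Solves C x = ∀ k → ∑ (λ j → x j * C j k) ≈ 0#

  NonTrivial : ∀ {d} → (Fin d → K) → Set ℓ
  NonTrivial x = ∃ λ j → ¬ x j ≈ 0#

  ¬¬-zero-or-nonTrivial : ∀ {d} (f : Fin d → K) → ¬ ¬ ((∀ j → f j ≈ 0#) ⊎ NonTrivial f)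
  ¬¬-zero-or-nonTrivial {zero}  f = return (inj₁ λ ())
  ¬¬-zero-or-nonTrivial {suc d} f = do
    yes f₀≈0 ← ¬¬-excluded-middle
      where no f₀≉0 → return (inj₂ (Fin.zero , f₀≉0))
    inj₁ rest≈0 ← ¬¬-zero-or-nonTrivial (f ∘ Fin.suc)
      where inj₂ (j , fⱼ≉0) → return (inj₂ (Fin.suc j , fⱼ≉0))
    return (inj₁ λ { Fin.zero → f₀≈0 ; (Fin.suc j) → rest≈0 j })

  -[ab]c+a[bc]≈0 : ∀ a b c → - (a * b) * c + a * (b * c) ≈ 0#
  -[ab]c+a[bc]≈0 a b c = begin
    - (a * b) * c + a * (b * c)   ≈⟨ +-congʳ (-‿distribˡ-* (a * b) c) ⟨
    - (a * b * c) + a * (b * c)   ≈⟨ +-congʳ (-‿cong (*-assoc a b c)) ⟩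
    - (a * (b * c)) + a * (b * c) ≈⟨ -‿inverseˡ _ ⟩
    0#                            ∎

  -- Gaussian elimination of column 0 of C using the pivot C p 0 with inverse α.
  module Eliminate {d m} (C : Fin (suc d) → Fin (suc m) → K)
                   (p : Fin (suc d)) (α : K) (pivot : C p Fin.zero * α ≈ 1#) where

    β : Fin m → K
    β k = α * C p (Fin.suc k)

    reduced : Fin d → Fin m → K
    reduced j k = C (punchIn p j) (Fin.suc k) - C (punchIn p j) Fin.zero * β k

    module _ (y : Fin d → K) (y-solves : Solves reduced y) where

      S : K
      S = ∑ (λ j → y j * C (punchIn p j) Fin.zero)

      lift : Fin (suc d) → K
      lift = insertAt y p (- (S * α))

      lift-column : ∀ k → ∑ (λ i → lift i * C i k) ≈ - (S * α) * C p k + ∑ (λ j → y j * C (punchIn p j) k)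
      lift-column k = trans (∑-punchIn p (λ i → lift i * C i k))
        (+-cong (*-congʳ (reflexive (insertAt-lookup y p _)))
                (∑-cong (λ j → *-congʳ (reflexive (insertAt-punchIn y p _ j)))))

      reduced-column : ∀ k → ∑ (λ j → y j * C (punchIn p j) (Fin.suc k)) ≈ S * β k
      reduced-column k = x∙y⁻¹≈ε⇒x≈y _ _ (begin
        ∑ (λ j → y j * C (punchIn p j) (Fin.suc k)) - S * β k
          ≈⟨ +-congˡ (-‿cong (*-distribʳ-∑ (β k) (λ j → y j * C (punchIn p j) Fin.zero))) ⟩
        ∑ (λ j → y j * C (punchIn p j) (Fin.suc k)) - ∑ (λ j → y j * C (punchIn p j) Fin.zero * β k)
          ≈⟨ ∑-distrib-- (λ j → y j * C (punchIn p j) (Fin.suc k)) (λ j → y j * C (punchIn p j) Fin.zero * β k) ⟨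
        ∑ (λ j → y j * C (punchIn p j) (Fin.suc k) - y j * C (punchIn p j) Fin.zero * β k)
          ≈⟨ ∑-cong (λ j → trans (+-congˡ (-‿cong (*-assoc _ _ _))) (sym (x[y-z]≈xy-xz (y j) _ _))) ⟩
        ∑ (λ j → y j * reduced j k)
          ≈⟨ y-solves k ⟩
        0# ∎)

      lift-solves : Solves C lift
      lift-solves Fin.zero = begin
        ∑ (λ i → lift i * C i Fin.zero)                   ≈⟨ lift-column Fin.zero ⟩
        - (S * α) * C p Fin.zero + S                      ≈⟨ +-congˡ (trans (sym (*-identityʳ S)) (*-congˡ (trans (sym pivot) (*-comm _ α)))) ⟩
        - (S * α) * C p Fin.zero + S * (α * C p Fin.zero) ≈⟨ -[ab]c+a[bc]≈0 S α _ ⟩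
        0#                                                ∎
      lift-solves (Fin.suc k) = begin
        ∑ (λ i → lift i * C i (Fin.suc k))                    ≈⟨ lift-column (Fin.suc k) ⟩
        - (S * α) * C p (Fin.suc k) + ∑ (λ j → y j * C (punchIn p j) (Fin.suc k)) ≈⟨ +-congˡ (reduced-column k) ⟩
        - (S * α) * C p (Fin.suc k) + S * β k                  ≈⟨ -[ab]c+a[bc]≈0 S α _ ⟩
        0#                                                      ∎

  -- Only double-negated: equality in k is undecidable, so pivots are found by excluded middle.
  ¬¬-nonTrivial-solution : ∀ {m d} (C : Fin d → Fin m → K) → m < d → ¬ ¬ (∃ λ x → NonTrivial x × Solves C x)
  ¬¬-nonTrivial-solution {zero} {suc d} C _ = return ((λ _ → 1#) , (Fin.zero , 0≉1 ∘ sym) , λ ())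
  ¬¬-nonTrivial-solution {suc m} {suc d} C (s≤s m<d) = do
    inj₂ (p , Cₚ₀≉0) ← ¬¬-zero-or-nonTrivial (λ j → C j Fin.zero)
      where inj₁ column₀≈0 → do
              (x , nonTrivial , x-solves) ← ¬¬-nonTrivial-solution (λ j k → C j (Fin.suc k)) (ℕ.m<n⇒m<1+n m<d)
              return (x , nonTrivial , λ { Fin.zero → ∑-zero (λ j → trans (*-congˡ (column₀≈0 j)) (zeroʳ (x j)))
                                         ; (Fin.suc k) → x-solves k })
    let (α , pivot) = inverse (C p Fin.zero) Cₚ₀≉0
    (y , (j , yⱼ≉0) , y-solves) ← ¬¬-nonTrivial-solution (Eliminate.reduced C p α pivot) m<d
    return (Eliminate.lift C p α pivot y y-solves
           , (punchIn p j , λ liftⱼ≈0 → yⱼ≉0 (trans (sym (reflexive (insertAt-punchIn y p _ j))) liftⱼ≈0))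
           , Eliminate.lift-solves C p α pivot y y-solves)

  record Subspace {n} (S : Vect n → Set ℓ) : Set (c ⊔ ℓ) where
    field
      resp-≋         : ∀ {u v} → u ≋ v → S u → S v
      lincomb-closed : ∀ {k} (cs : Fin k → K) (w : Fin k → Vect n) → (∀ j → S (w j)) → S (lincomb cs w)

  LinIndepMod : ∀ {n d} → (Vect n → Set ℓ) → (Fin d → Vect n) → Set (c ⊔ ℓ)
  LinIndepMod S u = ∀ cs → S (lincomb cs u) → ∀ j → cs j ≈ 0#

  InSpanMod : ∀ {n m} → (Vect n → Set ℓ) → (Fin m → Vect n) → Vect n → Set (c ⊔ ℓ)
  InSpanMod S v w = ∃ λ cs → S (w ⊖ lincomb cs v)

  lincomb-⊖-solution : ∀ {n d m} (u : Fin d → Vect n) (v : Fin m → Vect n) (C : Fin d → Fin m → K) x →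
    Solves C x → lincomb x (λ j → u j ⊖ lincomb (C j) v) ≋ lincomb x u
  lincomb-⊖-solution u v C x x-solves r = begin
    ∑ (λ j → x j * (u j r - ∑ (λ k → C j k * v k r)))           ≈⟨ ∑-cong (λ j → x[y-z]≈xy-xz (x j) _ _) ⟩
    ∑ (λ j → x j * u j r - x j * ∑ (λ k → C j k * v k r))       ≈⟨ ∑-distrib-- (λ j → x j * u j r) _ ⟩
    lincomb x u r - ∑ (λ j → x j * ∑ (λ k → C j k * v k r))     ≈⟨ +-congˡ (-‿cong vanishes) ⟩
    lincomb x u r - 0#                                          ≈⟨ +-congˡ -0#≈0# ⟩
    lincomb x u r + 0#                                          ≈⟨ +-identityʳ _ ⟩
    lincomb x u r                                               ∎
    where
    vanishes : ∑ (λ j → x j * ∑ (λ k → C j k * v k r)) ≈ 0#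
    vanishes = begin
      ∑ (λ j → x j * ∑ (λ k → C j k * v k r))   ≈⟨ ∑-cong (λ j → *-distribˡ-∑ (x j) (λ k → C j k * v k r)) ⟩
      ∑ (λ j → ∑ (λ k → x j * (C j k * v k r))) ≈⟨ ∑-comm (λ j k → x j * (C j k * v k r)) ⟩
      ∑ (λ k → ∑ (λ j → x j * (C j k * v k r))) ≈⟨ ∑-cong (λ k → ∑-cong (λ j → *-assoc (x j) (C j k) (v k r))) ⟨
      ∑ (λ k → ∑ (λ j → x j * C j k * v k r))   ≈⟨ ∑-cong (λ k → *-distribʳ-∑ (v k r) (λ j → x j * C j k)) ⟨
      ∑ (λ k → ∑ (λ j → x j * C j k) * v k r)   ≈⟨ ∑-zero (λ k → trans (*-congʳ (x-solves k)) (zeroˡ _)) ⟩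
      0#                                        ∎

  independent≤spanning : ∀ {n d m} {S : Vect n → Set ℓ} → Subspace S →
    (u : Fin d → Vect n) (v : Fin m → Vect n) → LinIndepMod S u → (∀ j → InSpanMod S v (u j)) → d ℕ.≤ m
  independent≤spanning {d = d} {m} S u v u-indep u∈span with d ℕ.≤? m
  ... | yes d≤m = d≤m
  ... | no d≰m = ⊥-elim (¬¬-nonTrivial-solution C (ℕ.≰⇒> d≰m) λ (x , (j , xⱼ≉0) , x-solves) →
    xⱼ≉0 (u-indep x (resp-≋ (lincomb-⊖-solution u v C x x-solves)
                             (lincomb-closed x _ (proj₂ ∘ u∈span))) j))
    where
    open Subspace S
    C : Fin d → Fin m → K
    C = proj₁ ∘ u∈span

  QuotDim-unique : ∀ {n d d′} {W S : Vect n → Set ℓ} → Subspace S → QuotDim W S d → QuotDim W S d′ → d ≡ d′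
  QuotDim-unique S (b , b∈W , b-indep , b-spans) (b′ , b′∈W , b′-indep , b′-spans) = ℕ.≤-antisym
    (independent≤spanning S b b′ b-indep (λ j → b′-spans (b j) (b∈W j)))
    (independent≤spanning S b′ b b′-indep (λ j → b-spans (b′ j) (b′∈W j)))

  ∑ℕ : ℕ → (ℕ → K) → K
  ∑ℕ zero    F = 0#
  ∑ℕ (suc m) F = F 0 + ∑ℕ m (F ∘ suc)

  extend : ∀ {m} → (Fin m → K) → ℕ → K
  extend {zero}  f k       = 0#
  extend {suc m} f zero    = f Fin.zero
  extend {suc m} f (suc k) = extend (f ∘ Fin.suc) k

  extend-toℕ : ∀ {m} (f : Fin m → K) l → extend f (toℕ l) ≡ f l
  extend-toℕ f Fin.zero    = ≡.refl
  extend-toℕ f (Fin.suc l) = extend-toℕ (f ∘ Fin.suc) l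

  ∑-toℕ : ∀ m (F : ℕ → K) → ∑ {m} (F ∘ toℕ) ≈ ∑ℕ m F
  ∑-toℕ zero    F = refl
  ∑-toℕ (suc m) F = +-congˡ (∑-toℕ m (F ∘ suc))

  ∑ℕ-cong : ∀ m {F G : ℕ → K} → (∀ k → k < m → F k ≈ G k) → ∑ℕ m F ≈ ∑ℕ m G
  ∑ℕ-cong zero    F≈G = refl
  ∑ℕ-cong (suc m) F≈G = +-cong (F≈G 0 (s≤s z≤n)) (∑ℕ-cong m (λ k k<m → F≈G (suc k) (s≤s k<m)))

  ∑ℕ-zero : ∀ m {F : ℕ → K} → (∀ k → k < m → F k ≈ 0#) → ∑ℕ m F ≈ 0#
  ∑ℕ-zero m F≈0 = trans (∑ℕ-cong m F≈0) (∑ℕ-0 m)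
    where
    ∑ℕ-0 : ∀ m → ∑ℕ m (λ _ → 0#) ≈ 0#
    ∑ℕ-0 zero    = refl
    ∑ℕ-0 (suc m) = trans (+-identityˡ _) (∑ℕ-0 m)

  ∑ℕ-+ : ∀ p q (F : ℕ → K) → ∑ℕ (p ℕ.+ q) F ≈ ∑ℕ p F + ∑ℕ q (λ k → F (p ℕ.+ k))
  ∑ℕ-+ zero    q F = sym (+-identityˡ _)
  ∑ℕ-+ (suc p) q F = trans (+-congˡ (∑ℕ-+ p q (F ∘ suc))) (sym (+-assoc _ _ _))

  ∑ℕ-single : ∀ m p (F : ℕ → K) → p < m → (∀ k → k < m → k ≢ p → F k ≈ 0#) → ∑ℕ m F ≈ F p
  ∑ℕ-single (suc m) zero    F _         F≈0 =
    trans (+-congˡ (∑ℕ-zero m (λ k k<m → F≈0 (suc k) (s≤s k<m) λ ()))) (+-identityʳ _)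
  ∑ℕ-single (suc m) (suc p) F (s≤s p<m) F≈0 =
    trans (+-cong (F≈0 0 (s≤s z≤n) λ ()) (∑ℕ-single m p (F ∘ suc) p<m (λ k k<m k≢p → F≈0 (suc k) (s≤s k<m) (k≢p ∘ ℕ.suc-injective))))
          (+-identityˡ _)

  shift : ℕ → (ℕ → K) → ℕ → K
  shift s F k = if does (s ℕ.≤? k) then F (k ∸ s) else 0#

  shift-≥ : ∀ s F l → shift s F (s ℕ.+ l) ≡ F l
  shift-≥ s F l rewrite dec-true (s ℕ.≤? s ℕ.+ l) (ℕ.m≤m+n s l) = ≡.cong F (ℕ.m+n∸m≡n s l)

  shift-< : ∀ s F k → k < s → shift s F k ≡ 0#
  shift-< s F k k<s rewrite dec-false (s ℕ.≤? k) (ℕ.<⇒≱ k<s) = ≡.refl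

  -- Reindexing l ↦ s + l; the terms pushed past m vanish because G does.
  ∑ℕ-shift : ∀ m s (F G : ℕ → K) → (∀ k → m ℕ.≤ k → G k ≈ 0#) →
    ∑ℕ m (λ l → F l * G (s ℕ.+ l)) ≈ ∑ℕ m (λ k → shift s F k * G k)
  ∑ℕ-shift m s F G G≈0 = begin
    ∑ℕ m (λ l → F l * G (s ℕ.+ l))                              ≈⟨ +-identityˡ _ ⟨
    0# + ∑ℕ m (λ l → F l * G (s ℕ.+ l))                         ≈⟨ +-cong (sym (∑ℕ-zero s below-s)) (∑ℕ-cong m (λ l _ → *-congʳ (reflexive (≡.sym (shift-≥ s F l))))) ⟩
    ∑ℕ s H + ∑ℕ m (λ l → H (s ℕ.+ l))                           ≈⟨ ∑ℕ-+ s m H ⟨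
    ∑ℕ (s ℕ.+ m) H                                              ≡⟨ ≡.cong (λ k → ∑ℕ k H) (ℕ.+-comm s m) ⟩
    ∑ℕ (m ℕ.+ s) H                                              ≈⟨ ∑ℕ-+ m s H ⟩
    ∑ℕ m H + ∑ℕ s (λ k → H (m ℕ.+ k))                           ≈⟨ +-congˡ (∑ℕ-zero s (λ k _ → trans (*-congˡ (G≈0 (m ℕ.+ k) (ℕ.m≤m+n m k))) (zeroʳ _))) ⟩
    ∑ℕ m H + 0#                                                 ≈⟨ +-identityʳ _ ⟩
    ∑ℕ m H                                                      ∎
    where
    H : ℕ → K
    H k = shift s F k * G k
    below-s : ∀ k → k < s → H k ≈ 0#
    below-s k k<s = trans (*-congʳ (reflexive (shift-< s F k k<s))) (zeroˡ _)

  module Operator {n : ℕ} (A : Mat n) where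

    apply-cong : ∀ {u v} → u ≋ v → apply A u ≋ apply A v
    apply-cong u≋v r = ∑-cong (λ s → *-congˡ (u≋v s))

    apply-∑v : ∀ {m} (f : Fin m → Vect n) → apply A (∑v f) ≋ ∑v (apply A ∘ f)
    apply-∑v f r = trans (∑-cong (λ s → *-distribˡ-∑ (A r s) (λ j → f j s))) (∑-comm (λ s j → A r s * f j s))

    apply-· : ∀ a v → apply A (a · v) ≋ (a · apply A v)
    apply-· a v r = begin
      ∑ (λ s → A r s * (a * v s)) ≈⟨ ∑-cong (λ s → trans (sym (*-assoc _ _ _)) (trans (*-congʳ (*-comm (A r s) a)) (*-assoc _ _ _))) ⟩
      ∑ (λ s → a * (A r s * v s)) ≈⟨ *-distribˡ-∑ a (λ s → A r s * v s) ⟨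
      a * ∑ (λ s → A r s * v s)   ∎

    apply-⊖ : ∀ u v → apply A (u ⊖ v) ≋ (apply A u ⊖ apply A v)
    apply-⊖ u v r = trans (∑-cong (λ s → x[y-z]≈xy-xz (A r s) (u s) (v s))) (∑-distrib-- (λ s → A r s * u s) (λ s → A r s * v s))

    apply-𝟎 : apply A 𝟎 ≋ 𝟎
    apply-𝟎 r = ∑-zero (λ s → zeroʳ (A r s))

    pow-cong : ∀ m {u v} → u ≋ v → pow A m u ≋ pow A m v
    pow-cong zero    u≋v = u≋v
    pow-cong (suc m) u≋v = apply-cong (pow-cong m u≋v)

    pow-∑v : ∀ m {k} (f : Fin k → Vect n) → pow A m (∑v f) ≋ ∑v (pow A m ∘ f)
    pow-∑v zero    f r = refl
    pow-∑v (suc m) f r = trans (apply-cong (pow-∑v m f) r) (apply-∑v (pow A m ∘ f) r)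

    pow-· : ∀ m a v → pow A m (a · v) ≋ (a · pow A m v)
    pow-· zero    a v r = refl
    pow-· (suc m) a v r = trans (apply-cong (pow-· m a v) r) (apply-· a (pow A m v) r)

    pow-⊖ : ∀ m u v → pow A m (u ⊖ v) ≋ (pow A m u ⊖ pow A m v)
    pow-⊖ zero    u v r = refl
    pow-⊖ (suc m) u v r = trans (apply-cong (pow-⊖ m u v) r) (apply-⊖ (pow A m u) (pow A m v) r)

    pow-𝟎 : ∀ m → pow A m 𝟎 ≋ 𝟎
    pow-𝟎 zero    r = refl
    pow-𝟎 (suc m) r = trans (apply-cong (pow-𝟎 m) r) (apply-𝟎 r)

    pow-+ : ∀ m k v → pow A (m ℕ.+ k) v ≡ pow A m (pow A k v)
    pow-+ zero    k v = ≡.refl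
    pow-+ (suc m) k v = ≡.cong (apply A) (pow-+ m k v)

    pow-lincomb : ∀ m {k} (cs : Fin k → K) (w : Fin k → Vect n) → pow A m (lincomb cs w) ≋ lincomb cs (pow A m ∘ w)
    pow-lincomb m cs w r = trans (pow-∑v m (λ j → cs j · w j) r) (∑-cong (λ j → pow-· m (cs j) (w j) r))

    Ker-subspace : ∀ i → Subspace (Ker A i)
    Ker-subspace i = record
      { resp-≋         = λ u≋v u∈Ker r → trans (pow-cong i (sym ∘ u≋v) r) (u∈Ker r)
      ; lincomb-closed = λ cs w w∈Ker r → trans (pow-lincomb i cs w r) (∑-zero (λ j → trans (*-congˡ (w∈Ker j r)) (zeroʳ (cs j))))
      }

  scatter : ∀ {h} (a : Fin h → ℕ) i → (Fin (countAbove i (tabulate a)) → K) → Fin h → K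
  scatter {suc h} a i x j with i <ᵇ a Fin.zero
  scatter {suc h} a i x Fin.zero    | true  = x Fin.zero
  scatter {suc h} a i x (Fin.suc j) | true  = scatter (a ∘ Fin.suc) i (x ∘ Fin.suc) j
  scatter {suc h} a i x Fin.zero    | false = 0#
  scatter {suc h} a i x (Fin.suc j) | false = scatter (a ∘ Fin.suc) i x j

  scatter-select : ∀ {h} (a : Fin h → ℕ) i x t → scatter a i x (select a i t) ≡ x t
  scatter-select {suc h} a i x t with i <ᵇ a Fin.zero
  scatter-select {suc h} a i x Fin.zero    | true  = ≡.refl
  scatter-select {suc h} a i x (Fin.suc t) | true  = scatter-select (a ∘ Fin.suc) i (x ∘ Fin.suc) t
  scatter-select {suc h} a i x t           | false = scatter-select (a ∘ Fin.suc) i x t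

  scatter-outside : ∀ {h} (a : Fin h → ℕ) i x j → ¬ i < a j → scatter a i x j ≈ 0#
  scatter-outside {suc h} a i x j i≮aⱼ with i <ᵇ a Fin.zero | ℕ.<ᵇ-reflects-< i (a Fin.zero)
  scatter-outside {suc h} a i x Fin.zero    i≮a₀ | true  | ofʸ i<a₀ = contradiction i<a₀ i≮a₀
  scatter-outside {suc h} a i x (Fin.suc j) i≮aⱼ | true  | _        = scatter-outside (a ∘ Fin.suc) i (x ∘ Fin.suc) j i≮aⱼ
  scatter-outside {suc h} a i x Fin.zero    i≮a₀ | false | _        = refl
  scatter-outside {suc h} a i x (Fin.suc j) i≮aⱼ | false | _        = scatter-outside (a ∘ Fin.suc) i x j i≮aⱼ

  scatter-restrict : ∀ {h} (a : Fin h → ℕ) i (y : Fin h → K) → (∀ j → ¬ i < a j → y j ≈ 0#) →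
    ∀ j → scatter a i (y ∘ select a i) j ≈ y j
  scatter-restrict {suc h} a i y y≈0 j with i <ᵇ a Fin.zero | ℕ.<ᵇ-reflects-< i (a Fin.zero)
  scatter-restrict {suc h} a i y y≈0 Fin.zero    | true  | _        = refl
  scatter-restrict {suc h} a i y y≈0 (Fin.suc j) | true  | _        = scatter-restrict (a ∘ Fin.suc) i (y ∘ Fin.suc) (y≈0 ∘ Fin.suc) j
  scatter-restrict {suc h} a i y y≈0 Fin.zero    | false | ofⁿ i≮a₀ = sym (y≈0 Fin.zero i≮a₀)
  scatter-restrict {suc h} a i y y≈0 (Fin.suc j) | false | _        = scatter-restrict (a ∘ Fin.suc) i (y ∘ Fin.suc) (y≈0 ∘ Fin.suc) j

  ∑-select : ∀ {h} (a : Fin h → ℕ) i x (f : Fin h → K) →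
    ∑ (λ t → x t * f (select a i t)) ≈ ∑ (λ j → scatter a i x j * f j)
  ∑-select {zero}  a i x f = refl
  ∑-select {suc h} a i x f with i <ᵇ a Fin.zero
  ... | true  = +-congˡ (∑-select (a ∘ Fin.suc) i (x ∘ Fin.suc) (f ∘ Fin.suc))
  ... | false = trans (∑-select (a ∘ Fin.suc) i x (f ∘ Fin.suc))
                      (trans (sym (+-identityˡ _)) (+-congʳ (sym (zeroˡ (f Fin.zero)))))

  module Decomposed {n : ℕ} (A : Mat n) {h : ℕ} (a : Fin h → ℕ) (deco : Decomposition A h a) where
    open Operator A

    g : Fin h → Vect n
    g = proj₁ deco

    g-nil : ∀ j → pow A (a j) (g j) ≋ 𝟎
    g-nil = proj₁ (proj₂ deco)

    φ : ((j : Fin h) → Fin (a j) → K) → Vect n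
    φ cs = ∑v (λ j → ∑v (λ l → cs j l · pow A (toℕ l) (g j)))

    g-indep : ∀ cs → φ cs ≋ 𝟎 → ∀ j l → cs j l ≈ 0#
    g-indep = proj₁ (proj₂ (proj₂ deco))

    g-span : ∀ v → ∃ λ cs → v ≋ φ cs
    g-span = proj₂ (proj₂ (proj₂ deco))

    Tg : Fin h → ℕ → Vect n
    Tg j k = pow A k (g j)

    Tg-nil : ∀ j k → a j ℕ.≤ k → Tg j k ≋ 𝟎
    Tg-nil j k aⱼ≤k r = begin
      pow A k (g j) r                        ≡⟨ ≡.cong (λ m → pow A m (g j) r) (ℕ.m∸n+n≡m aⱼ≤k) ⟨
      pow A (k ∸ a j ℕ.+ a j) (g j) r        ≡⟨ ≡.cong (λ v → v r) (pow-+ (k ∸ a j) (a j) (g j)) ⟩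
      pow A (k ∸ a j) (pow A (a j) (g j)) r  ≈⟨ pow-cong (k ∸ a j) (g-nil j) r ⟩
      pow A (k ∸ a j) 𝟎 r                    ≈⟨ pow-𝟎 (k ∸ a j) r ⟩
      0#                                     ∎

    pow-φ : ∀ m cs r → pow A m (φ cs) r ≈ ∑ (λ j → ∑ (λ l → cs j l * Tg j (m ℕ.+ toℕ l) r))
    pow-φ m cs r = trans (pow-∑v m (λ j → ∑v (λ l → cs j l · Tg j (toℕ l))) r) (∑-cong λ j →
      trans (pow-∑v m (λ l → cs j l · Tg j (toℕ l)) r) (∑-cong λ l →
      trans (pow-· m (cs j l) (Tg j (toℕ l)) r) (*-congˡ (reflexive (≡.cong (λ v → v r) (≡.sym (pow-+ m (toℕ l) (g j))))))))

    pow-φ-extend : ∀ m cs r → pow A m (φ cs) r ≈ ∑ (λ j → ∑ℕ (a j) (λ l → extend (cs j) l * Tg j (m ℕ.+ l) r))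
    pow-φ-extend m cs r = trans (pow-φ m cs r) (∑-cong λ j →
      trans (∑-cong (λ l → *-congʳ (reflexive (≡.sym (extend-toℕ (cs j) l)))))
            (∑-toℕ (a j) (λ l → extend (cs j) l * Tg j (m ℕ.+ l) r)))

    φ-fromℕ : ∀ (H : Fin h → ℕ → K) r → φ (λ j l → H j (toℕ l)) r ≈ ∑ (λ j → ∑ℕ (a j) (λ k → H j k * Tg j k r))
    φ-fromℕ H r = trans (pow-φ 0 (λ j l → H j (toℕ l)) r) (∑-cong λ j → ∑-toℕ (a j) (λ k → H j k * Tg j k r))

    module Layer (i : ℕ) where

      top : Fin h → Vect n
      top j = Tg j (a j ∸ suc i)

      layer : Fin (countAbove i (tabulate a)) → Vect n
      layer t = top (select a i t)

      pow-top : ∀ j → i < a j → pow A i (top j) ≡ Tg j (a j ∸ 1)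
      pow-top j i<aⱼ = ≡.trans (≡.sym (pow-+ i (a j ∸ suc i) (g j)))
                               (≡.cong (λ m → pow A m (g j)) (i+[a∸[1+i]]≡a∸1 i<aⱼ))
        where
        i+[a∸[1+i]]≡a∸1 : ∀ {i a} → i < a → i ℕ.+ (a ∸ suc i) ≡ a ∸ 1
        i+[a∸[1+i]]≡a∸1 {a = suc a} (s≤s i≤a) = ℕ.m+[n∸m]≡n i≤a

      layer-∈Ker : ∀ t → Ker A (suc i) (layer t)
      layer-∈Ker t r = trans (reflexive (≡.cong (λ v → v r) (≡.sym (pow-+ (suc i) (a j ∸ suc i) (g j)))))
                             (Tg-nil j _ (ℕ.m≤n+m∸n (a j) (suc i)) r)
        where j = select a i t

      topCoeff : (Fin h → K) → Fin h → ℕ → K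
      topCoeff X j k = if does (k ℕ.≟ a j ∸ 1) then X j else 0#

      topCoeff-top : ∀ X j → topCoeff X j (a j ∸ 1) ≡ X j
      topCoeff-top X j rewrite dec-true (a j ∸ 1 ℕ.≟ a j ∸ 1) ≡.refl = ≡.refl

      topCoeff-off : ∀ X j k → k ≢ a j ∸ 1 → topCoeff X j k ≡ 0#
      topCoeff-off X j k k≢ rewrite dec-false (k ℕ.≟ a j ∸ 1) k≢ = ≡.refl

      topCoeff-zero : ∀ X j k → X j ≈ 0# → topCoeff X j k ≈ 0#
      topCoeff-zero X j k Xⱼ≈0 with k ℕ.≟ a j ∸ 1
      ... | yes ≡.refl = trans (reflexive (topCoeff-top X j)) Xⱼ≈0
      ... | no k≢      = reflexive (topCoeff-off X j k k≢)

      ∑ℕ-topCoeff : ∀ X j r → (¬ i < a j → X j ≈ 0#) →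
        ∑ℕ (a j) (λ k → topCoeff X j k * Tg j k r) ≈ X j * pow A i (top j) r
      ∑ℕ-topCoeff X j r X≈0 with i <? a j
      ... | yes i<aⱼ = begin
        ∑ℕ (a j) (λ k → topCoeff X j k * Tg j k r)
          ≈⟨ ∑ℕ-single (a j) (a j ∸ 1) (λ k → topCoeff X j k * Tg j k r) (n∸1<n i<aⱼ)
                       (λ k _ k≢ → trans (*-congʳ (reflexive (topCoeff-off X j k k≢))) (zeroˡ _)) ⟩
        topCoeff X j (a j ∸ 1) * Tg j (a j ∸ 1) r
          ≈⟨ *-cong (reflexive (topCoeff-top X j)) (reflexive (≡.cong (λ v → v r) (≡.sym (pow-top j i<aⱼ)))) ⟩
        X j * pow A i (top j) r ∎
      ... | no i≮aⱼ = trans (∑ℕ-zero (a j) (λ k _ → trans (*-congʳ (topCoeff-zero X j k (X≈0 i≮aⱼ))) (zeroˡ _)))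
                             (sym (trans (*-congʳ (X≈0 i≮aⱼ)) (zeroˡ _)))

      layer-indep : LinIndepMod (Ker A i) layer
      layer-indep x Tⁱ[x·layer]≈0 t = begin
        x t                        ≡⟨ scatter-select a i x t ⟨
        X j                        ≡⟨ topCoeff-top X j ⟨
        topCoeff X j (a j ∸ 1)     ≡⟨ ≡.cong (topCoeff X j) (toℕ-fromℕ< top<aⱼ) ⟨
        cs j (Fin.fromℕ< top<aⱼ)   ≈⟨ g-indep cs φ[cs]≈0 j (Fin.fromℕ< top<aⱼ) ⟩
        0#                         ∎
        where
        X = scatter a i x
        j = select a i t
        top<aⱼ = n∸1<n (select-above a i t)
        cs : (j : Fin h) → Fin (a j) → K
        cs j l = topCoeff X j (toℕ l)
        φ[cs]≈0 : φ cs ≋ 𝟎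
        φ[cs]≈0 r = begin
          φ cs r                                                 ≈⟨ φ-fromℕ (topCoeff X) r ⟩
          ∑ (λ j → ∑ℕ (a j) (λ k → topCoeff X j k * Tg j k r)) ≈⟨ ∑-cong (λ j → ∑ℕ-topCoeff X j r (scatter-outside a i x j)) ⟩
          ∑ (λ j → X j * pow A i (top j) r)                    ≈⟨ ∑-select a i x (λ j → pow A i (top j) r) ⟨
          ∑ (λ t → x t * pow A i (layer t) r)                  ≈⟨ pow-lincomb i x layer r ⟨
          pow A i (lincomb x layer) r                          ≈⟨ Tⁱ[x·layer]≈0 r ⟩
          0#                                                   ∎

      layer-span : ∀ v → Ker A (suc i) v → InSpanMod (Ker A i) layer v
      layer-span v Tⁱ⁺¹v≈0 = y , Tⁱ[v⊖y·layer]≈0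
        where
        cs : (j : Fin h) → Fin (a j) → K
        cs = proj₁ (g-span v)
        v≋φ[cs] : v ≋ φ cs
        v≋φ[cs] = proj₂ (g-span v)
        ĉ : Fin h → ℕ → K
        ĉ j = extend (cs j)

        shifted : (j : Fin h) → Fin (a j) → K
        shifted j l = shift (suc i) (ĉ j) (toℕ l)

        φ[shifted]≈0 : φ shifted ≋ 𝟎
        φ[shifted]≈0 r = begin
          φ shifted r                                                  ≈⟨ φ-fromℕ (λ j → shift (suc i) (ĉ j)) r ⟩
          ∑ (λ j → ∑ℕ (a j) (λ k → shift (suc i) (ĉ j) k * Tg j k r)) ≈⟨ ∑-cong (λ j → ∑ℕ-shift (a j) (suc i) (ĉ j) (λ k → Tg j k r) (λ k aⱼ≤k → Tg-nil j k aⱼ≤k r)) ⟨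
          ∑ (λ j → ∑ℕ (a j) (λ l → ĉ j l * Tg j (suc i ℕ.+ l) r))   ≈⟨ pow-φ-extend (suc i) cs r ⟨
          pow A (suc i) (φ cs) r                                       ≈⟨ pow-cong (suc i) v≋φ[cs] r ⟨
          pow A (suc i) v r                                            ≈⟨ Tⁱ⁺¹v≈0 r ⟩
          0#                                                           ∎

        ĉ-high : ∀ j l → suc i ℕ.+ l < a j → ĉ j l ≈ 0#
        ĉ-high j l 1+i+l<aⱼ = begin
          ĉ j l                                   ≡⟨ shift-≥ (suc i) (ĉ j) l ⟨
          shift (suc i) (ĉ j) (suc i ℕ.+ l)       ≡⟨ ≡.cong (shift (suc i) (ĉ j)) (toℕ-fromℕ< 1+i+l<aⱼ) ⟨
          shifted j (Fin.fromℕ< 1+i+l<aⱼ)         ≈⟨ g-indep shifted φ[shifted]≈0 j (Fin.fromℕ< 1+i+l<aⱼ) ⟩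
          0#                                      ∎

        y′ : Fin h → K
        y′ j = if does (i <? a j) then ĉ j (a j ∸ suc i) else 0#

        y′-outside : ∀ j → ¬ i < a j → y′ j ≈ 0#
        y′-outside j i≮aⱼ rewrite dec-false (i <? a j) i≮aⱼ = refl

        y′-above : ∀ j → i < a j → y′ j ≡ ĉ j (a j ∸ suc i)
        y′-above j i<aⱼ rewrite dec-true (i <? a j) i<aⱼ = ≡.refl

        y : Fin (countAbove i (tabulate a)) → K
        y = y′ ∘ select a i

        Tⁱ-generator : ∀ j r → ∑ℕ (a j) (λ l → ĉ j l * Tg j (i ℕ.+ l) r) ≈ y′ j * pow A i (top j) r
        Tⁱ-generator j r with i <? a j
        ... | yes i<aⱼ = begin
          ∑ℕ (a j) (λ l → ĉ j l * Tg j (i ℕ.+ l) r) ≈⟨ ∑ℕ-single (a j) p _ (n∸[1+m]<n i<aⱼ) off-top ⟩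
          ĉ j p * Tg j (i ℕ.+ p) r                  ≈⟨ *-cong (reflexive (≡.sym (y′-above j i<aⱼ))) (reflexive (≡.cong (λ v → v r) (pow-+ i p (g j)))) ⟩
          y′ j * pow A i (top j) r                  ∎
          where
          p = a j ∸ suc i
          off-top : ∀ k → k < a j → k ≢ p → ĉ j k * Tg j (i ℕ.+ k) r ≈ 0#
          off-top k _ k≢p with suc i ℕ.+ k ℕ.<? a j
          ... | yes high = trans (*-congʳ (ĉ-high j k high)) (zeroˡ _)
          ... | no ≮     = trans (*-congˡ (Tg-nil j (i ℕ.+ k) (n≤m+k i (a j) k ≮ k≢p) r)) (zeroʳ _)
        ... | no i≮aⱼ = trans (∑ℕ-zero (a j) (λ k _ → trans (*-congˡ (Tg-nil j (i ℕ.+ k) (ℕ.≤-trans (ℕ.≮⇒≥ i≮aⱼ) (ℕ.m≤m+n i k)) r)) (zeroʳ _)))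
                              (sym (trans (*-congʳ (y′-outside j i≮aⱼ)) (zeroˡ _)))

        Tⁱv≈Tⁱ[y·layer] : ∀ r → pow A i v r ≈ pow A i (lincomb y layer) r
        Tⁱv≈Tⁱ[y·layer] r = begin
          pow A i v r                                               ≈⟨ pow-cong i v≋φ[cs] r ⟩
          pow A i (φ cs) r                                          ≈⟨ pow-φ-extend i cs r ⟩
          ∑ (λ j → ∑ℕ (a j) (λ l → ĉ j l * Tg j (i ℕ.+ l) r))      ≈⟨ ∑-cong (λ j → Tⁱ-generator j r) ⟩
          ∑ (λ j → y′ j * pow A i (top j) r)                        ≈⟨ ∑-cong (λ j → *-congʳ (scatter-restrict a i y′ y′-outside j)) ⟨
          ∑ (λ j → scatter a i y j * pow A i (top j) r)             ≈⟨ ∑-select a i y (λ j → pow A i (top j) r) ⟨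
          ∑ (λ t → y t * pow A i (layer t) r)                       ≈⟨ pow-lincomb i y layer r ⟨
          pow A i (lincomb y layer) r                               ∎

        Tⁱ[v⊖y·layer]≈0 : Ker A i (v ⊖ lincomb y layer)
        Tⁱ[v⊖y·layer]≈0 r = begin
          pow A i (v ⊖ lincomb y layer) r                           ≈⟨ pow-⊖ i v (lincomb y layer) r ⟩
          pow A i v r - pow A i (lincomb y layer) r                 ≈⟨ +-congˡ (-‿cong (Tⁱv≈Tⁱ[y·layer] r)) ⟨
          pow A i v r - pow A i v r                                 ≈⟨ -‿inverseʳ _ ⟩
          0#                                                        ∎

      layer-QuotDim : QuotDim (Ker A (suc i)) (Ker A i) (countAbove i (tabulate a))
      layer-QuotDim = layer , layer-∈Ker , layer-indep , layer-span

mainTheorem3 : ∀ {c ℓ : Level} (F : Field c ℓ) → let open LinAlg F in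
    (e h : ℕ) → {{_ : NonZero e}} → {{_ : NonZero h}} →
    (n : ℕ) (A : Mat n) → KillsTe A e → GeneratedBy A e h →
    (δ : Fin e → ℕ) →
    (∀ i → QuotDim (Ker A (suc (toℕ i))) (Ker A (toℕ i)) (δ i)) →
    (a : Fin h → ℕ) → (∀ i → a i ≤ e) → Decomposition A h a →
    ∀ (x : ℚ) → 0ℚ ≤ℚ x → x ≤ℚ ℕ→ℚ h →
    Hdg e a x ≡ P e h δ x
mainTheorem3 F (suc e) h n A _ _ δ δ-QuotDim a a≤e deco x _ x≤h = ≡.trans
  (Polygon.Hdg≡P-countAbove e h a a≤e x x≤h)
  (Polygon.P-cong (suc e) h (λ i → ≡.sym (δ≡countAbove i)) x)
  where
  open Linear F
  open Decomposed A a deco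
  δ≡countAbove : ∀ i → δ i ≡ countAbove (toℕ i) (tabulate a)
  δ≡countAbove i = QuotDim-unique (Operator.Ker-subspace A (toℕ i)) (δ-QuotDim i) (Layer.layer-QuotDim (toℕ i))
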